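{- Let $G$ be a critical tangle and let $s$ and $t$ be critical terms represented in it. Then whether $\mathrm{Gr}(t)=\mathrm{Gr}(s)$ (i.e. whether $s$ and $t$ have the same value) is decidable in a constant number of RAM operations of logarithmic word size.
   Context: Terms are ground terms over a finite vocabulary of constructors. The minimal term graph $\mathrm{Gr}(t)$ of a term $t$ is the DAG with one vertex per distinct subterm of $t$, labeled by its head symbol, with ordered edges to the vertices of its immediate subterms. A tangle of a finite set of terms is the single DAG obtained by merging their minimal term graphs so that each distinct term is represented by exactly one vertex; each term is accessed by a pointer to its vertex. It is stored in RAM memory where each cell holds a vertex label or a pointer. For an algorithm with a finite set $T$ of critical terms (closed under subterms) running on states whose domain is the set of constructor terms, the critical tangle of a state is the tangle of the constructor-term values of all critical terms in that state, with each critical term pointing to the vertex of its value. -}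

module Defs where

open import Data.Nat using (ℕ; zero; suc; _+_; _∸_; _≟_)
open import Relation.Nullary using (yes; no)
open import Data.Fin using (Fin; toℕ)
open import Data.Vec using (Vec; lookup; map)
open import Data.List using (List; []; _∷_)
open import Data.Maybe using (Maybe; just; nothing)
open import Data.Bool using (Bool; true; false)
open import Data.Product using (∃)
open import Relation.Binary.PropositionalEquality using (_≡_)
open import Function.Definitions using (Injective)

module _ {k : ℕ} (ar : Fin k → ℕ) where

  data Term : Set where
    node : (f : Fin k) → Vec Term (ar f) → Term

  data _⊑_ : Term → Term → Set where
    here  : ∀ {t} → t ⊑ t
    there : ∀ {u f ts} (i : Fin (ar f)) → u ⊑ lookup ts i → u ⊑ node f ts

  record Tangle : Set where
    field
      n        : ℕ
      label    : Fin n → Fin k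
      children : (v : Fin n) → Vec (Fin n) (ar (label v))
      val      : Fin n → Term
      val-node : ∀ v → val v ≡ node (label v) (map val (children v))
      val-inj  : Injective _≡_ _≡_ val

  -- The critical tangle of a state: critical terms indexed by Fin m,
  -- their values in the state given by  value ; the tangle consists
  -- exactly of the (subterms of the) values, each critical term
  -- pointing to the vertex of its value.
  record CriticalTangle {m : ℕ} (value : Fin m → Term) : Set where
    field
      G      : Tangle
    open Tangle G public
    field
      ptr     : Fin m → Fin n
      ptr-val : ∀ c → val (ptr c) ≡ value c
      covers  : ∀ v → ∃ λ c → val v ⊑ value c

_!?_ : List ℕ → ℕ → Maybe ℕ
[]       !? _     = nothing
(x ∷ xs) !? zero  = just x
(x ∷ xs) !? suc j = xs !? j

-- Vertex v is stored at address  addr v : its label in cell  addr v,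
-- followed by the addresses of its children.  Pointers = addresses.
record Stores {k : ℕ} {ar : Fin k → ℕ} (G : Tangle ar) (mem : List ℕ)
              (addr : Fin (Tangle.n G) → ℕ) : Set where
  open Tangle G
  field
    addr-inj : Injective _≡_ _≡_ addr
    lab-cell : ∀ v → mem !? addr v ≡ just (toℕ (label v))
    ch-cell  : ∀ v (i : Fin (ar (label v))) →
               mem !? (addr v + suc (toℕ i)) ≡ just (addr (lookup (children v) i))

-- A (read-only) RAM: unboundedly many registers, random-access loads.
-- Every instruction is one RAM operation.

data Instr : Set where
  const : (r w : ℕ) → Instr
  add   : (r a b : ℕ) → Instr
  sub   : (r a b : ℕ) → Instr
  load  : (r a : ℕ) → Instr          -- R[r] := M[R[a]]  (0 if out of range)
  jz    : (r l : ℕ) → Instr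
  halt  : Instr

Program : Set
Program = List Instr

record Config : Set where
  constructor cfg
  field
    pc     : ℕ
    regs   : ℕ → ℕ
    halted : Bool
open Config public

set : (ℕ → ℕ) → ℕ → ℕ → (ℕ → ℕ)
set R r w j with r ≟ j
... | yes _ = w
... | no  _ = R j

fetch : Program → ℕ → Maybe Instr
fetch []       _       = nothing
fetch (i ∷ is) zero    = just i
fetch (i ∷ is) (suc j) = fetch is j

readM : List ℕ → ℕ → ℕ
readM mem a with mem !? a
... | just x  = x
... | nothing = 0

exec : List ℕ → Config → Instr → Config
exec mem (cfg p R h) (const r w) = cfg (suc p) (set R r w) h
exec mem (cfg p R h) (add r a b) = cfg (suc p) (set R r (R a + R b)) h
exec mem (cfg p R h) (sub r a b) = cfg (suc p) (set R r (R a ∸ R b)) h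
exec mem (cfg p R h) (load r a)  = cfg (suc p) (set R r (readM mem (R a))) h
exec mem (cfg p R h) (jz r l) with R r
... | zero  = cfg l R h
... | suc _ = cfg (suc p) R h
exec mem (cfg p R h) halt = cfg p R true

step : Program → List ℕ → Config → Config
step P mem c with halted c
... | true  = c
... | false with fetch P (pc c)
...   | just i  = exec mem c i
...   | nothing = record c { halted = true }

run : Program → List ℕ → ℕ → Config → Config
run P mem zero    c = c
run P mem (suc i) c = run P mem i (step P mem c)

init : ℕ → ℕ → Config
init x y = cfg 0 R false
  where
    R : ℕ → ℕ
    R zero          = x
    R (suc zero)    = y
    R (suc (suc _)) = 0

-- Maximal sharing makes value equality pointer equality: the tangle represents
-- each term by exactly one vertex and distinct vertices are stored at distinct
-- addresses, so  value s ≡ value t  iff the two input pointers coincide.  Two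
-- truncated subtractions and two zero tests decide that, and since they never
-- produce a number larger than their inputs, every register stays bounded by
-- the size of the memory.
module Submission where

open import Defs
open import Data.Nat using (ℕ; zero; suc; _≤_; _<_; _^_; _∸_; _≟_; z≤n; s≤s)
open import Data.Nat.Properties
  using (≤-trans; ≤-antisym; m<n⇒m≤1+n; m∸n≤m; m∸n≡0⇒m≤n; n∸n≡0; ^-identityʳ)
open import Data.Fin using (Fin)
open import Data.List using (List; length; []; _∷_)
open import Data.List.Relation.Unary.All using (All; []; _∷_)
open import Data.Bool using (true; false)
open import Data.Maybe using (just; nothing)
open import Data.Product using (Σ; _×_; _,_)
open import Relation.Nullary using (yes; no)
open import Function.Bundles using (_⇔_; mk⇔)
open import Function.Definitions using (Injective)
import Function.Properties.Equivalence as ⇔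
open import Relation.Binary.PropositionalEquality using (_≡_; refl; sym; trans; cong; subst)

Injective⇒≡⇔ : ∀ {A B : Set} {f : A → B} → Injective _≡_ _≡_ f →
               ∀ {x y} → (f x ≡ f y) ⇔ (x ≡ y)
Injective⇒≡⇔ f-inj = mk⇔ f-inj (cong _)

module _ {k} {ar : Fin k → ℕ} {m} {value : Fin m → Term ar}
         (CT : CriticalTangle ar value) where
  open CriticalTangle CT

  ptr-≡⇔value-≡ : ∀ {s t} → (ptr s ≡ ptr t) ⇔ (value s ≡ value t)
  ptr-≡⇔value-≡ {s} {t} = mk⇔
    (λ eq → trans (sym (ptr-val s)) (trans (cong val eq) (ptr-val t)))
    (λ eq → val-inj (trans (ptr-val s) (trans eq (sym (ptr-val t)))))

  address-≡⇔value-≡ : ∀ {mem addr} → Stores G mem addr →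
                      ∀ {s t} → (addr (ptr s) ≡ addr (ptr t)) ⇔ (value s ≡ value t)
  address-≡⇔value-≡ stored =
    ⇔.trans (Injective⇒≡⇔ (Stores.addr-inj stored)) ptr-≡⇔value-≡

!?-just⇒<length : ∀ (mem : List ℕ) a {w} → mem !? a ≡ just w → a < length mem
!?-just⇒<length (_ ∷ mem) zero    _  = s≤s z≤n
!?-just⇒<length (_ ∷ mem) (suc a) eq = s≤s (!?-just⇒<length mem a eq)

address<length : ∀ {k} {ar : Fin k → ℕ} {G : Tangle ar} {mem addr} →
                 Stores G mem addr → ∀ v → addr v < length mem
address<length {mem = mem} {addr} stored v =
  !?-just⇒<length mem (addr v) (Stores.lab-cell stored v)

∸-both-zero⇔≡ : ∀ {x y} → (x ∸ y ≡ 0 × y ∸ x ≡ 0) ⇔ (x ≡ y)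
∸-both-zero⇔≡ {x} = mk⇔
  (λ (x∸y≡0 , y∸x≡0) → ≤-antisym (m∸n≡0⇒m≤n x∸y≡0) (m∸n≡0⇒m≤n y∸x≡0))
  (λ { refl → n∸n≡0 x , n∸n≡0 x })

record Decides (c : Config) (A : Set) : Set where
  constructor _,_
  field
    halts  : halted c ≡ true
    answer : (regs c 0 ≡ 1) ⇔ A

Decides-resp-⇔ : ∀ {c A B} → Decides c A → A ⇔ B → Decides c B
Decides-resp-⇔ (halts , answer) A⇔B = halts , ⇔.trans answer A⇔B

equalityTest : Program
equalityTest =
  sub 2 0 1 ∷ jz 2 4 ∷ const 0 0 ∷ halt ∷
  sub 3 1 0 ∷ jz 3 8 ∷ const 0 0 ∷ halt ∷
  const 0 1 ∷ halt ∷ []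

-- Register 3 is abstracted as  set R 3 e  (and register 2 likewise below) so that
-- the zero test can be decided by matching on  e .
secondTest-decides : ∀ mem R e →
  Decides (run equalityTest mem 3 (cfg 5 (set R 3 e) false)) (e ≡ 0)
secondTest-decides mem R zero    = refl , mk⇔ (λ _ → refl) (λ _ → refl)
secondTest-decides mem R (suc e) = refl , mk⇔ (λ ()) (λ ())

firstTest-decides : ∀ mem R d →
  Decides (run equalityTest mem 5 (cfg 1 (set R 2 d) false)) (d ≡ 0 × R 1 ∸ R 0 ≡ 0)
firstTest-decides mem R zero =
  Decides-resp-⇔ (secondTest-decides mem (set R 2 0) (R 1 ∸ R 0))
                 (mk⇔ (refl ,_) (λ (_ , e≡0) → e≡0))
firstTest-decides mem R (suc d) = refl , mk⇔ (λ ()) (λ { (() , _) })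

equalityTest-decides : ∀ mem x y → Decides (run equalityTest mem 6 (init x y)) (x ≡ y)
equalityTest-decides mem x y =
  Decides-resp-⇔ (firstTest-decides mem (regs (init x y)) (x ∸ y)) ∸-both-zero⇔≡

data RespectsBound (B : ℕ) : Instr → Set where
  const : ∀ r {w} → w ≤ B → RespectsBound B (const r w)
  sub   : ∀ r a b → RespectsBound B (sub r a b)
  jz    : ∀ r l → RespectsBound B (jz r l)
  halt  : RespectsBound B halt

RegistersBounded : ℕ → Config → Set
RegistersBounded B c = ∀ r → regs c r ≤ B

set-bounded : ∀ {B R} r {w} → (∀ j → R j ≤ B) → w ≤ B → ∀ j → set R r w j ≤ B
set-bounded r R≤B w≤B j with r ≟ j
... | yes _ = w≤B
... | no  _ = R≤B j

exec-bounded : ∀ {B} mem c {i} → RespectsBound B i →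
               RegistersBounded B c → RegistersBounded B (exec mem c i)
exec-bounded mem (cfg p R h) (const r w≤B) R≤B = set-bounded r R≤B w≤B
exec-bounded mem (cfg p R h) (sub r a b)   R≤B = set-bounded r R≤B (≤-trans (m∸n≤m (R a) (R b)) (R≤B a))
exec-bounded mem (cfg p R h) (jz r l)      R≤B with R r
... | zero  = R≤B
... | suc _ = R≤B
exec-bounded mem (cfg p R h) halt          R≤B = R≤B

fetch-All : ∀ {P : Instr → Set} {prog} → All P prog → ∀ p {i} → fetch prog p ≡ just i → P i
fetch-All (Pi ∷ _)    zero    refl = Pi
fetch-All (_  ∷ Pis)  (suc p) eq   = fetch-All Pis p eq

step-bounded : ∀ {B prog} → All (RespectsBound B) prog → ∀ mem c →
               RegistersBounded B c → RegistersBounded B (step prog mem c)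
step-bounded {prog = prog} ok mem c R≤B with halted c
... | true = R≤B
... | false with fetch prog (pc c) in fetched
...   | just i  = exec-bounded mem c (fetch-All ok (pc c) fetched) R≤B
...   | nothing = R≤B

run-bounded : ∀ {B prog} → All (RespectsBound B) prog → ∀ mem i c →
              RegistersBounded B c → RegistersBounded B (run prog mem i c)
run-bounded ok mem zero    c R≤B = R≤B
run-bounded {prog = prog} ok mem (suc i) c R≤B =
  run-bounded ok mem i (step prog mem c) (step-bounded ok mem c R≤B)

equalityTest-respects : ∀ {B} → 1 ≤ B → All (RespectsBound B) equalityTest
equalityTest-respects 1≤B =
  sub 2 0 1 ∷ jz 2 4 ∷ const 0 z≤n ∷ halt ∷
  sub 3 1 0 ∷ jz 3 8 ∷ const 0 z≤n ∷ halt ∷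
  const 0 1≤B ∷ halt ∷ []

init-bounded : ∀ {B x y} → x ≤ B → y ≤ B → RegistersBounded B (init x y)
init-bounded x≤B y≤B zero          = x≤B
init-bounded x≤B y≤B (suc zero)    = y≤B
init-bounded x≤B y≤B (suc (suc _)) = z≤n

mainTheorem3 : Σ Program λ P → Σ ℕ λ K → Σ ℕ λ c →
    ∀ {k} (ar : Fin k → ℕ) {m} (value : Fin m → Term ar)
    (CT : CriticalTangle ar value) (mem : List ℕ)
    (addr : Fin (Tangle.n (CriticalTangle.G CT)) → ℕ) →
    Stores (CriticalTangle.G CT) mem addr →
    (s t : Fin m) →
    let c₀ = init (addr (CriticalTangle.ptr CT s)) (addr (CriticalTangle.ptr CT t))
    in  (halted (run P mem K c₀) ≡ true)
    × ((regs (run P mem K c₀) 0 ≡ 1) ⇔ (value s ≡ value t))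
    × (∀ i → i ≤ K → ∀ r → regs (run P mem i c₀) r ≤ suc (length mem) ^ c)
mainTheorem3 = equalityTest , 6 , 1 , λ ar value CT mem addr stored s t →
  let open CriticalTangle CT
      open Decides (equalityTest-decides mem (addr (ptr s)) (addr (ptr t)))
      bounded : ∀ {a} → a ≤ suc (length mem) → a ≤ suc (length mem) ^ 1
      bounded = ≤1+n⇒≤1+n^1 (length mem)
      address-bounded : ∀ v → addr v ≤ suc (length mem) ^ 1
      address-bounded v = bounded (m<n⇒m≤1+n (address<length stored v))
  in halts
   , ⇔.trans answer (address-≡⇔value-≡ CT stored)
   , λ i _ → run-bounded (equalityTest-respects (bounded (s≤s z≤n))) mem i
               (init (addr (ptr s)) (addr (ptr t)))
               (init-bounded (address-bounded (ptr s)) (address-bounded (ptr t)))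
  where
  ≤1+n⇒≤1+n^1 : ∀ n {a} → a ≤ suc n → a ≤ suc n ^ 1
  ≤1+n⇒≤1+n^1 n {a} = subst (a ≤_) (sym (^-identityʳ (suc n)))
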